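{- For integers $n\ge k\ge 0$, $$\sum_{l=0}^{n-k}\binom{n-k}{l}(-1)^l\xi_{k+l,q}=\sum_{l=0}^{k}\binom{k}{l}(-1)^{k+l}\xi_{n-l,1/q}(2).$$
   Context: Let $p$ be an odd prime, $\mathbb{C}_p$ the completion of an algebraic closure of $\mathbb{Q}_p$, and $q\in\mathbb{C}_p$ with $|1-q|_p<1$ (then also $|1-q^{ -1}|_p<1$). For $Q\in\{q,q^{ -1}\}$ put $[x]_Q=\frac{1-Q^x}{1-Q}$. The $Q$-Euler numbers $\xi_{n,Q}$ are defined by $\xi_{0,Q}=1$ and, for $n\ge 1$, $Q\sum_{l=0}^{n}\binom{n}{l}Q^l\xi_{l,Q}+\xi_{n,Q}=0$. The $Q$-Euler polynomials are $\xi_{n,Q}(x)=\sum_{l=0}^{n}\binom{n}{l}[x]_Q^{\,n-l}Q^{lx}\xi_{l,Q}$; $\xi_{n,1/q}(x)$ denotes these for $Q=q^{ -1}$. -}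

module Defs where

open import Level using (Level)
open import Algebra.Bundles using (CommutativeRing)
open import Data.Nat as ℕ using (ℕ; zero; suc; _∸_)
open import Data.Nat.Combinatorics using (_C_)
open import Data.Product using (_×_)

-- q-Euler numbers/polynomials over a commutative ring R
-- (an abstract stand-in for ℂ_p).
module QEuler {c ℓ : Level} (R : CommutativeRing c ℓ) where
  open CommutativeRing R

  pow : Carrier → ℕ → Carrier
  pow Q zero    = 1#
  pow Q (suc n) = Q * pow Q n

  fromℕ : ℕ → Carrier
  fromℕ zero    = 0#
  fromℕ (suc n) = 1# + fromℕ n

  sign : ℕ → Carrier
  sign n = pow (- 1#) n

  sumTo : ℕ → (ℕ → Carrier) → Carrier
  sumTo zero    f = f 0
  sumTo (suc n) f = sumTo n f + f (suc n)

  -- [x]_Q = (1 - Q^x)/(1 - Q) = 1 + Q + ... + Q^(x-1)  (x ∈ ℕ)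
  qint : Carrier → ℕ → Carrier
  qint Q zero    = 0#
  qint Q (suc x) = 1# + Q * qint Q x

  IsQEulerNumbers : Carrier → (ℕ → Carrier) → Set ℓ
  IsQEulerNumbers Q ξ =
    (ξ 0 ≈ 1#) ×
    (∀ m → Q * sumTo (suc m) (λ l → fromℕ (suc m C l) * (pow Q l * ξ l)) + ξ (suc m) ≈ 0#)

  qEulerPoly : Carrier → (ℕ → Carrier) → ℕ → ℕ → Carrier
  qEulerPoly Q ξ n x =
    sumTo n (λ l → fromℕ (n C l) * (pow (qint Q x) (n ∸ l) * (pow Q (l ℕ.* x) * ξ l)))

{-# OPTIONS --safe #-}
module Submission where

open import Defs
open import Algebra.Bundles using (CommutativeRing)
open import Data.Nat as ℕ using (ℕ; zero; suc; _∸_; _≤_; _<_)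
open import Data.Nat.Properties as ℕ using ()
open import Data.Nat.Combinatorics using (_C_; nCn≡1; k>n⇒nCk≡0; nCk+nC[k+1]≡[n+1]C[k+1])
open import Data.Nat.Induction using (<-rec)
open import Level using (_⊔_)
open import Data.Product using (∃; _,_; proj₁; proj₂)
open import Relation.Nullary using (yes; no)
import Relation.Binary.PropositionalEquality as P
import Relation.Binary.Reasoning.Setoid as SetoidReasoning
import Algebra.Properties.Ring as RingProperties
import Algebra.Solver.Ring.NaturalCoefficients.Default as NaturalSolver

-- Write E for the shift x ↦ (i ↦ x (1 + i)) of sequences.  The q-Euler
-- recurrence says q ((qE + 1)^n ξ)₀ + ξₙ = 0, and ξ_{n,Q}(x) is
-- (([x]_Q + Q^x E)^n ξ)₀, so everything is a statement about the operators
-- aE + b.  Composing them, the sequence (-q)^n ((qE + 1)^n ξ)₀ satisfies the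
-- q⁻¹-recurrence, hence equals ξ_{·,q⁻¹} (solutions are unique when every
-- 1 + q^m is a unit); substituting it into ξ_{n,q⁻¹}(2) collapses the
-- operator to 1 - E.  The theorem then follows from
-- ((1 - E)^{n-k} E^k ξ)₀ = ((1 - E)^{n-k} (1 - (1 - E))^k ξ)₀.

module UmbralCalculus {c ℓ} (R : CommutativeRing c ℓ) where
  open CommutativeRing R
  open QEuler R
  open RingProperties ring using (-1*x≈-x; -‿involutive)
  open SetoidReasoning setoid
  open NaturalSolver commutativeSemiring using (solve; _:+_; _:*_; _:=_)

  fromℕ-+ : ∀ m n → fromℕ (m ℕ.+ n) ≈ fromℕ m + fromℕ n
  fromℕ-+ zero    n = sym (+-identityˡ _)
  fromℕ-+ (suc m) n = trans (+-congˡ (fromℕ-+ m n)) (sym (+-assoc _ _ _))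

  fromℕ-1 : fromℕ 1 ≈ 1#
  fromℕ-1 = +-identityʳ 1#

  fromℕ-nCn : ∀ n → fromℕ (n C n) ≈ 1#
  fromℕ-nCn n = trans (reflexive (P.cong fromℕ (nCn≡1 n))) fromℕ-1

  pow-cong : ∀ {a b} n → a ≈ b → pow a n ≈ pow b n
  pow-cong zero    a≈b = refl
  pow-cong (suc n) a≈b = *-cong a≈b (pow-cong n a≈b)

  pow-+ : ∀ a m n → pow a (m ℕ.+ n) ≈ pow a m * pow a n
  pow-+ a zero    n = sym (*-identityˡ _)
  pow-+ a (suc m) n = trans (*-congˡ (pow-+ a m n)) (sym (*-assoc _ _ _))

  pow-*-distrib : ∀ a b n → pow a n * pow b n ≈ pow (a * b) n
  pow-*-distrib a b zero    = *-identityˡ 1#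
  pow-*-distrib a b (suc n) =
    trans (interchange a b (pow a n) (pow b n)) (*-congˡ (pow-*-distrib a b n))
    where
    interchange : ∀ a b x y → (a * x) * (b * y) ≈ (a * b) * (x * y)
    interchange = solve 4 (λ a b x y → (a :* x) :* (b :* y) := (a :* b) :* (x :* y)) refl

  pow-1# : ∀ n → pow 1# n ≈ 1#
  pow-1# zero    = refl
  pow-1# (suc n) = trans (*-identityˡ _) (pow-1# n)

  pow-inverse : ∀ {a b} n → a * b ≈ 1# → pow a n * pow b n ≈ 1#
  pow-inverse n ab≈1 = trans (pow-*-distrib _ _ n) (trans (pow-cong n ab≈1) (pow-1# n))

  pow-*ℕ : ∀ a l x → pow a (l ℕ.* x) ≈ pow (pow a x) l
  pow-*ℕ a zero    x = refl
  pow-*ℕ a (suc l) x = trans (pow-+ a x (l ℕ.* x)) (*-congˡ (pow-*ℕ a l x))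

  sumTo-cong : ∀ n {f g : ℕ → Carrier} → (∀ i → i ≤ n → f i ≈ g i) → sumTo n f ≈ sumTo n g
  sumTo-cong zero    f≈g = f≈g 0 ℕ.z≤n
  sumTo-cong (suc n) f≈g =
    +-cong (sumTo-cong n (λ i i≤n → f≈g i (ℕ.m≤n⇒m≤1+n i≤n))) (f≈g (suc n) ℕ.≤-refl)

  sumTo-split-first : ∀ n f → sumTo (suc n) f ≈ f 0 + sumTo n (λ i → f (suc i))
  sumTo-split-first zero    f = refl
  sumTo-split-first (suc n) f = trans (+-congʳ (sumTo-split-first n f)) (+-assoc _ _ _)

  sumTo-+ : ∀ n f g → sumTo n (λ i → f i + g i) ≈ sumTo n f + sumTo n g
  sumTo-+ zero    f g = refl
  sumTo-+ (suc n) f g = trans (+-congʳ (sumTo-+ n f g)) (medial _ _ _ _)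
    where
    medial : ∀ a b c d → (a + b) + (c + d) ≈ (a + c) + (b + d)
    medial = solve 4 (λ a b c d → (a :+ b) :+ (c :+ d) := (a :+ c) :+ (b :+ d)) refl

  sumTo-distribˡ : ∀ n a f → sumTo n (λ i → a * f i) ≈ a * sumTo n f
  sumTo-distribˡ zero    a f = refl
  sumTo-distribˡ (suc n) a f = trans (+-congʳ (sumTo-distribˡ n a f)) (sym (distribˡ _ _ _))

  shift : (ℕ → Carrier) → ℕ → Carrier
  shift x i = x (suc i)

  -- umbral a b x n = ((aE + b)^n x)₀
  umbral : Carrier → Carrier → (ℕ → Carrier) → ℕ → Carrier
  umbral a b x zero    = x 0
  umbral a b x (suc n) = b * umbral a b x n + a * umbral a b (shift x) n

  umbral-cong : ∀ {a a′ b b′} → a ≈ a′ → b ≈ b′ → ∀ n {x y : ℕ → Carrier} →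
                (∀ i → x i ≈ y i) → umbral a b x n ≈ umbral a′ b′ y n
  umbral-cong a≈a′ b≈b′ zero    x≈y = x≈y 0
  umbral-cong a≈a′ b≈b′ (suc n) x≈y =
    +-cong (*-cong b≈b′ (umbral-cong a≈a′ b≈b′ n x≈y))
           (*-cong a≈a′ (umbral-cong a≈a′ b≈b′ n (λ i → x≈y (suc i))))

  umbral-linear : ∀ a b n u v x y →
    umbral a b (λ i → u * x i + v * y i) n ≈ u * umbral a b x n + v * umbral a b y n
  umbral-linear a b zero    u v x y = refl
  umbral-linear a b (suc n) u v x y =
    trans (+-cong (*-congˡ (umbral-linear a b n u v x y))
                  (*-congˡ (umbral-linear a b n u v (shift x) (shift y))))
          (regroup a b u v _ _ _ _)
    where
    regroup : ∀ a b u v X Y X′ Y′ →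
      b * (u * X + v * Y) + a * (u * X′ + v * Y′) ≈ u * (b * X + a * X′) + v * (b * Y + a * Y′)
    regroup = solve 8 (λ a b u v X Y X′ Y′ →
      b :* (u :* X :+ v :* Y) :+ a :* (u :* X′ :+ v :* Y′)
        := u :* (b :* X :+ a :* X′) :+ v :* (b :* Y :+ a :* Y′)) refl

  -- (aE + b)^n applied to the sequence ((cE + d)^i x)₀ is (a(cE + d) + b)^n x
  umbral-∘ : ∀ a b c d n x → umbral a b (umbral c d x) n ≈ umbral (a * c) (a * d + b) x n
  umbral-∘ a b c d zero    x = refl
  umbral-∘ a b c d (suc n) x = begin
    b * umbral a b (umbral c d x) n + a * umbral a b (λ i → d * umbral c d x i + c * umbral c d (shift x) i) n
      ≈⟨ +-congˡ (*-congˡ (umbral-linear a b n d c (umbral c d x) (umbral c d (shift x)))) ⟩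
    b * umbral a b (umbral c d x) n
      + a * (d * umbral a b (umbral c d x) n + c * umbral a b (umbral c d (shift x)) n)
      ≈⟨ +-cong (*-congˡ (umbral-∘ a b c d n x))
                (*-congˡ (+-cong (*-congˡ (umbral-∘ a b c d n x)) (*-congˡ (umbral-∘ a b c d n (shift x))))) ⟩
    b * X + a * (d * X + c * Y) ≈⟨ regroup a b c d X Y ⟩
    (a * d + b) * X + (a * c) * Y ∎
    where
    X Y : Carrier
    X = umbral (a * c) (a * d + b) x n
    Y = umbral (a * c) (a * d + b) (shift x) n
    regroup : ∀ a b c d X Y → b * X + a * (d * X + c * Y) ≈ (a * d + b) * X + (a * c) * Y
    regroup = solve 6 (λ a b c d X Y →
      b :* X :+ a :* (d :* X :+ c :* Y) := (a :* d :+ b) :* X :+ (a :* c) :* Y) refl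

  umbral-0# : ∀ a n x → umbral a 0# x n ≈ pow a n * x n
  umbral-0# a zero    x = sym (*-identityˡ _)
  umbral-0# a (suc n) x = begin
    0# * umbral a 0# x n + a * umbral a 0# (shift x) n
      ≈⟨ +-cong (zeroˡ _) (*-congˡ (umbral-0# a n (shift x))) ⟩
    0# + a * (pow a n * x (suc n)) ≈⟨ +-identityˡ _ ⟩
    a * (pow a n * x (suc n))      ≈⟨ *-assoc _ _ _ ⟨
    pow a (suc n) * x (suc n)      ∎

  umbral-scale : ∀ e a b n x → umbral (e * a) (e * b) x n ≈ pow e n * umbral a b x n
  umbral-scale e a b n x = begin
    umbral (e * a) (e * b) x n      ≈⟨ umbral-cong refl (+-identityʳ _) n (λ _ → refl) ⟨
    umbral (e * a) (e * b + 0#) x n ≈⟨ umbral-∘ e 0# a b n x ⟨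
    umbral e 0# (umbral a b x) n    ≈⟨ umbral-0# e n (umbral a b x) ⟩
    pow e n * umbral a b x n        ∎

  binomialTerm : Carrier → Carrier → (ℕ → Carrier) → ℕ → ℕ → Carrier
  binomialTerm a b x n i = fromℕ (n C i) * (pow b (n ∸ i) * (pow a i * x i))

  -- for i > n, suc n ∸ i ≢ suc (n ∸ i), but then the coefficient vanishes
  choose-pow-suc∸ : ∀ b n i → fromℕ (n C i) * pow b (suc n ∸ i) ≈ b * (fromℕ (n C i) * pow b (n ∸ i))
  choose-pow-suc∸ b n i with i ℕ.≤? n
  ... | yes i≤n = begin
    fromℕ (n C i) * pow b (suc n ∸ i)   ≡⟨ P.cong (λ e → fromℕ (n C i) * pow b e) (ℕ.+-∸-assoc 1 i≤n) ⟩
    fromℕ (n C i) * (b * pow b (n ∸ i)) ≈⟨ x[yz]≈y[xz] (fromℕ (n C i)) b (pow b (n ∸ i)) ⟩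
    b * (fromℕ (n C i) * pow b (n ∸ i)) ∎
    where
    x[yz]≈y[xz] : ∀ x y z → x * (y * z) ≈ y * (x * z)
    x[yz]≈y[xz] = solve 3 (λ x y z → x :* (y :* z) := y :* (x :* z)) refl
  ... | no i≰n = begin
    fromℕ (n C i) * pow b (suc n ∸ i)   ≈⟨ trans (*-congʳ nCi≈0) (zeroˡ _) ⟩
    0#                                  ≈⟨ trans (*-congˡ (trans (*-congʳ nCi≈0) (zeroˡ _))) (zeroʳ b) ⟨
    b * (fromℕ (n C i) * pow b (n ∸ i)) ∎
    where
    nCi≈0 : fromℕ (n C i) ≈ 0#
    nCi≈0 = reflexive (P.cong fromℕ (k>n⇒nCk≡0 (ℕ.≰⇒> i≰n)))

  binomialTerm-pascal : ∀ a b x n j →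
    binomialTerm a b x (suc n) (suc j) ≈ a * binomialTerm a b (shift x) n j + b * binomialTerm a b x n (suc j)
  binomialTerm-pascal a b x n j = begin
    fromℕ (suc n C suc j) * (B * (A′ * X))
      ≈⟨ *-congʳ (reflexive (P.cong fromℕ (P.sym (nCk+nC[k+1]≡[n+1]C[k+1] n j)))) ⟩
    fromℕ (n C j ℕ.+ n C suc j) * (B * (A′ * X))
      ≈⟨ *-congʳ (fromℕ-+ (n C j) (n C suc j)) ⟩
    (c₁ + c₂) * (B * (A′ * X))
      ≈⟨ regroup c₁ c₂ a B (pow a j) X ⟩
    a * (c₁ * (B * (pow a j * X))) + (c₂ * B) * (A′ * X)
      ≈⟨ +-congˡ (trans (*-congʳ (choose-pow-suc∸ b n (suc j))) (trans (*-assoc _ _ _) (*-congˡ (*-assoc _ _ _)))) ⟩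
    a * binomialTerm a b (shift x) n j + b * binomialTerm a b x n (suc j) ∎
    where
    c₁ c₂ B A′ X : Carrier
    c₁ = fromℕ (n C j)
    c₂ = fromℕ (n C suc j)
    B  = pow b (n ∸ j)
    A′ = pow a (suc j)
    X  = x (suc j)
    regroup : ∀ c₁ c₂ a B P X →
      (c₁ + c₂) * (B * ((a * P) * X)) ≈ a * (c₁ * (B * (P * X))) + (c₂ * B) * ((a * P) * X)
    regroup = solve 6 (λ c₁ c₂ a B P X →
      (c₁ :+ c₂) :* (B :* ((a :* P) :* X)) := a :* (c₁ :* (B :* (P :* X))) :+ (c₂ :* B) :* ((a :* P) :* X)) refl

  umbral-sum : ∀ a b n x → sumTo n (binomialTerm a b x n) ≈ umbral a b x n
  umbral-sum a b zero x = trans (*-cong fromℕ-1 (trans (*-identityˡ _) (*-identityˡ _))) (*-identityˡ _)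
  umbral-sum a b (suc n) x = begin
    sumTo (suc n) (T (suc n))
      ≈⟨ sumTo-split-first n _ ⟩
    T (suc n) 0 + sumTo n (λ j → T (suc n) (suc j))
      ≈⟨ +-cong (lowerEnd (fromℕ 1) b (pow b n) (1# * x 0))
                (trans (sumTo-cong n (λ j _ → binomialTerm-pascal a b x n j)) (sumTo-+ n _ _)) ⟩
    b * T n 0 + (sumTo n (λ j → a * binomialTerm a b (shift x) n j) + sumTo n (λ j → b * T n (suc j)))
      ≈⟨ +-congˡ (+-cong (sumTo-distribˡ n a _) (sumTo-distribˡ n b _)) ⟩
    b * T n 0 + (a * sumTo n (binomialTerm a b (shift x) n) + b * sumTo n (λ j → T n (suc j)))
      ≈⟨ regroup b a _ _ _ ⟩
    b * (T n 0 + sumTo n (λ j → T n (suc j))) + a * sumTo n (binomialTerm a b (shift x) n)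
      ≈⟨ +-cong (*-congˡ (sym (sumTo-split-first n _))) (*-congˡ (umbral-sum a b n (shift x))) ⟩
    b * sumTo (suc n) (T n) + a * umbral a b (shift x) n
      ≈⟨ +-congʳ (*-congˡ (trans (+-congˡ (trans (*-congʳ nC[1+n]≈0) (zeroˡ _))) (+-identityʳ _))) ⟩
    b * sumTo n (T n) + a * umbral a b (shift x) n
      ≈⟨ +-congʳ (*-congˡ (umbral-sum a b n x)) ⟩
    b * umbral a b x n + a * umbral a b (shift x) n ∎
    where
    T : ℕ → ℕ → Carrier
    T = binomialTerm a b x
    nC[1+n]≈0 : fromℕ (n C suc n) ≈ 0#
    nC[1+n]≈0 = reflexive (P.cong fromℕ (k>n⇒nCk≡0 (ℕ.n<1+n n)))
    lowerEnd : ∀ k b p y → k * ((b * p) * y) ≈ b * (k * (p * y))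
    lowerEnd = solve 4 (λ k b p y → k :* ((b :* p) :* y) := b :* (k :* (p :* y))) refl
    regroup : ∀ b a t u v → b * t + (a * u + b * v) ≈ b * (t + v) + a * u
    regroup = solve 5 (λ b a t u v → b :* t :+ (a :* u :+ b :* v) := b :* (t :+ v) :+ a :* u) refl

  umbral-sum₁ : ∀ a n x → sumTo n (λ i → fromℕ (n C i) * (pow a i * x i)) ≈ umbral a 1# x n
  umbral-sum₁ a n x = trans (sumTo-cong n (λ i _ → *-congˡ (sym (dropOnes (n ∸ i))))) (umbral-sum a 1# n x)
    where
    dropOnes : ∀ i {y} → pow 1# i * y ≈ y
    dropOnes i = trans (*-congʳ (pow-1# i)) (*-identityˡ _)

  -1*-1≈1 : - 1# * - 1# ≈ 1#
  -1*-1≈1 = trans (-1*x≈-x (- 1#)) (-‿involutive 1#)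

  -1*x+x≈0 : ∀ x → - 1# * x + x ≈ 0#
  -1*x+x≈0 x = trans (+-congʳ (-1*x≈-x x)) (-‿inverseˡ x)

  sign-∸ : ∀ {k l} → l ≤ k → sign (k ∸ l) ≈ sign (k ℕ.+ l)
  sign-∸ {k} {l} l≤k = sym (begin
    sign (k ℕ.+ l)                        ≡⟨ P.cong sign k+l≡[k∸l]+[l+l] ⟩
    sign ((k ∸ l) ℕ.+ (l ℕ.+ l))          ≈⟨ pow-+ (- 1#) (k ∸ l) (l ℕ.+ l) ⟩
    sign (k ∸ l) * sign (l ℕ.+ l)         ≈⟨ *-congˡ (trans (pow-+ (- 1#) l l) (pow-inverse l -1*-1≈1)) ⟩
    sign (k ∸ l) * 1#                     ≈⟨ *-identityʳ _ ⟩
    sign (k ∸ l)                          ∎)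
    where
    k+l≡[k∸l]+[l+l] : k ℕ.+ l P.≡ (k ∸ l) ℕ.+ (l ℕ.+ l)
    k+l≡[k∸l]+[l+l] = P.trans (P.cong (ℕ._+ l) (P.sym (ℕ.m∸n+n≡m l≤k))) (ℕ.+-assoc (k ∸ l) l l)

  -- Σ_l C(k,l) (-1)^(k-l) ((1 - E)^(k+r-l) x)₀ = ((1 - E)^r (1 - (1 - E))^k x)₀
  umbral-alternating : ∀ x k r →
    umbral 1# (- 1#) (λ i → umbral (- 1#) 1# x (k ℕ.+ r ∸ i)) k ≈ umbral (- 1#) 1# (λ i → x (k ℕ.+ i)) r
  umbral-alternating x zero    r = refl
  umbral-alternating x (suc k) r = begin
    - 1# * umbral 1# (- 1#) (λ i → η (suc k ℕ.+ r ∸ i)) k + 1# * umbral 1# (- 1#) (λ i → η (k ℕ.+ r ∸ i)) k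
      ≈⟨ +-cong (*-congˡ (trans (umbral-cong refl refl k (λ i → reflexive (P.cong (λ e → η (e ∸ i)) suc[k+r]≡k+suc[r])))
                                (umbral-alternating x k (suc r))))
                (trans (*-identityˡ _) (umbral-alternating x k r)) ⟩
    - 1# * (1# * X + - 1# * Y) + X      ≈⟨ +-congʳ (*-congˡ (+-congʳ (*-identityˡ X))) ⟩
    - 1# * (X + - 1# * Y) + X           ≈⟨ regroup (- 1#) X Y ⟩
    (- 1# * - 1#) * Y + (- 1# * X + X)  ≈⟨ +-cong (trans (*-congʳ -1*-1≈1) (*-identityˡ Y)) (-1*x+x≈0 X) ⟩
    Y + 0#                              ≈⟨ +-identityʳ Y ⟩
    Y                                   ≈⟨ umbral-cong refl refl r (λ i → reflexive (P.cong x (ℕ.+-suc k i))) ⟩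
    umbral (- 1#) 1# (λ i → x (suc k ℕ.+ i)) r ∎
    where
    η : ℕ → Carrier
    η = umbral (- 1#) 1# x
    suc[k+r]≡k+suc[r] : suc (k ℕ.+ r) P.≡ k ℕ.+ suc r
    suc[k+r]≡k+suc[r] = P.sym (ℕ.+-suc k r)
    X Y : Carrier
    X = umbral (- 1#) 1# (λ i → x (k ℕ.+ i)) r
    Y = umbral (- 1#) 1# (λ i → x (k ℕ.+ suc i)) r
    regroup : ∀ m X Y → m * (X + m * Y) + X ≈ (m * m) * Y + (m * X + X)
    regroup = solve 3 (λ m X Y → m :* (X :+ m :* Y) :+ X := (m :* m) :* Y :+ (m :* X :+ X)) refl

module QEulerNumbers {c ℓ} (R : CommutativeRing c ℓ) where
  open CommutativeRing R
  open QEuler R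
  open UmbralCalculus R
  open RingProperties ring using (-1*x≈-x; -‿distribʳ-*; +-cancelˡ)
  open SetoidReasoning setoid
  open NaturalSolver commutativeSemiring using (solve; _:+_; _:*_; _:=_)

  HasUnitShifts : Carrier → Set (c ⊔ ℓ)
  HasUnitShifts Q = ∀ m → ∃ λ u → (1# + pow Q (suc m)) * u ≈ 1#

  unit-cancelˡ : ∀ {k u x y} → k * u ≈ 1# → k * x ≈ k * y → x ≈ y
  unit-cancelˡ {k} {u} {x} {y} ku≈1 kx≈ky = begin
    x           ≈⟨ trans (*-congʳ ku≈1) (*-identityˡ x) ⟨
    (k * u) * x ≈⟨ [xy]z≈y[xz] k u x ⟩
    u * (k * x) ≈⟨ *-congˡ kx≈ky ⟩
    u * (k * y) ≈⟨ [xy]z≈y[xz] k u y ⟨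
    (k * u) * y ≈⟨ trans (*-congʳ ku≈1) (*-identityˡ y) ⟩
    y           ∎
    where
    [xy]z≈y[xz] : ∀ k u x → (k * u) * x ≈ u * (k * x)
    [xy]z≈y[xz] = solve 3 (λ k u x → (k :* u) :* x := u :* (k :* x)) refl

  -- (1 + b^m)(a^m u) = a^m + 1 when ab = 1
  hasUnitShifts-inverse : ∀ {a b} → a * b ≈ 1# → HasUnitShifts a → HasUnitShifts b
  hasUnitShifts-inverse {a} {b} ab≈1 units m = pow a (suc m) * proj₁ (units m) , (begin
    (1# + B) * (A * u)    ≈⟨ regroup 1# B A u ⟩
    (1# * A + A * B) * u  ≈⟨ *-congʳ (+-cong (*-identityˡ A) (pow-inverse (suc m) ab≈1)) ⟩
    (A + 1#) * u          ≈⟨ *-congʳ (+-comm A 1#) ⟩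
    (1# + A) * u          ≈⟨ proj₂ (units m) ⟩
    1#                    ∎)
    where
    A B u : Carrier
    A = pow a (suc m)
    B = pow b (suc m)
    u = proj₁ (units m)
    regroup : ∀ o B A u → (o + B) * (A * u) ≈ (o * A + A * B) * u
    regroup = solve 4 (λ o B A u → (o :+ B) :* (A :* u) := (o :* A :+ A :* B) :* u) refl

  qEuler-step : ∀ {Q ξ} → IsQEulerNumbers Q ξ → ∀ m →
    Q * sumTo m (λ l → fromℕ (suc m C l) * (pow Q l * ξ l)) + (1# + pow Q (suc (suc m))) * ξ (suc m) ≈ 0#
  qEuler-step {Q} {ξ} (_ , recurrence) m = begin
    Q * S + (1# + Q * P) * X                       ≈⟨ regroup Q S 1# P X ⟩
    Q * (S + P * X) + 1# * X                       ≈⟨ +-congˡ (*-identityˡ X) ⟩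
    Q * (S + P * X) + X                            ≈⟨ +-congʳ (*-congˡ (+-congˡ topTerm)) ⟨
    Q * (S + fromℕ (suc m C suc m) * (P * X)) + X  ≈⟨ recurrence m ⟩
    0#                                             ∎
    where
    S P X : Carrier
    S = sumTo m (λ l → fromℕ (suc m C l) * (pow Q l * ξ l))
    P = pow Q (suc m)
    X = ξ (suc m)
    topTerm : fromℕ (suc m C suc m) * (P * X) ≈ P * X
    topTerm = trans (*-congʳ (fromℕ-nCn (suc m))) (*-identityˡ _)
    regroup : ∀ Q S o P X → Q * S + (o + Q * P) * X ≈ Q * (S + P * X) + o * X
    regroup = solve 5 (λ Q S o P X → Q :* S :+ (o :+ Q :* P) :* X := Q :* (S :+ P :* X) :+ o :* X) refl

  qEuler-unique : ∀ {Q x y} → HasUnitShifts Q → IsQEulerNumbers Q x → IsQEulerNumbers Q y → ∀ n → x n ≈ y n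
  qEuler-unique {Q} {x} {y} units isX isY = <-rec _ agree
    where
    S : (ℕ → Carrier) → ℕ → Carrier
    S z m = sumTo m (λ l → fromℕ (suc m C l) * (pow Q l * z l))
    agree : ∀ n → (∀ {l} → l < n → x l ≈ y l) → x n ≈ y n
    agree zero    _  = trans (proj₁ isX) (sym (proj₁ isY))
    agree (suc m) ih = unit-cancelˡ (proj₂ (units (suc m))) (+-cancelˡ (Q * S x m) _ _ (begin
      Q * S x m + K * x (suc m)  ≈⟨ qEuler-step isX m ⟩
      0#                         ≈⟨ qEuler-step isY m ⟨
      Q * S y m + K * y (suc m)  ≈⟨ +-congʳ (*-congˡ (sumTo-cong m (λ l l≤m → *-congˡ (*-congˡ (ih (ℕ.s≤s l≤m)))))) ⟨
      Q * S x m + K * y (suc m)  ∎))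
      where
      K : Carrier
      K = 1# + pow Q (suc (suc m))

  inverse-*-neg : ∀ {q q⁻¹} → q⁻¹ * q ≈ 1# → q⁻¹ * - q ≈ - 1#
  inverse-*-neg q⁻¹q≈1 = trans (sym (-‿distribʳ-* _ _)) (-‿cong q⁻¹q≈1)

  -- ξ_{n,q⁻¹} = (-q)^n ((qE + 1)^n ξ_{·,q})₀
  qEuler-inverse : ∀ {q q⁻¹ ξ} → q⁻¹ * q ≈ 1# → IsQEulerNumbers q ξ →
                   IsQEulerNumbers q⁻¹ (umbral (- q * q) (- q) ξ)
  qEuler-inverse {q} {q⁻¹} {ξ} q⁻¹q≈1 isξ@(ξ₀≈1 , recurrence) = ξ₀≈1 , λ m → let N = suc m in begin
    q⁻¹ * sumTo N (λ l → fromℕ (N C l) * (pow q⁻¹ l * Z l)) + Z N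
      ≈⟨ +-cong (*-congˡ (trans (umbral-sum₁ q⁻¹ N Z) (inverse-collapse N)))
                (trans (umbral-cong refl (sym (*-identityʳ _)) N (λ _ → refl)) (umbral-scale (- q) q 1# N ξ)) ⟩
    q⁻¹ * (P N * ξ N) + P N * umbral q 1# ξ N
      ≈⟨ +-congˡ (*-congˡ (trans (sym (*-identityˡ _)) (*-congʳ (sym q⁻¹q≈1)))) ⟩
    q⁻¹ * (P N * ξ N) + P N * ((q⁻¹ * q) * umbral q 1# ξ N)
      ≈⟨ factor q⁻¹ (P N) (ξ N) q (umbral q 1# ξ N) ⟩
    (P N * q⁻¹) * (q * umbral q 1# ξ N + ξ N)
      ≈⟨ *-congˡ (trans (+-congʳ (*-congˡ (sym (umbral-sum₁ q N ξ)))) (recurrence m)) ⟩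
    (P N * q⁻¹) * 0#
      ≈⟨ zeroʳ _ ⟩
    0# ∎
    where
    Z P : ℕ → Carrier
    Z = umbral (- q * q) (- q) ξ
    P = pow (- q)
    inverse-collapse : ∀ n → umbral q⁻¹ 1# Z n ≈ P n * ξ n
    inverse-collapse n = begin
      umbral q⁻¹ 1# Z n                                  ≈⟨ umbral-∘ q⁻¹ 1# (- q * q) (- q) n ξ ⟩
      umbral (q⁻¹ * (- q * q)) (q⁻¹ * - q + 1#) ξ n      ≈⟨ umbral-cong a≈-q b≈0 n (λ _ → refl) ⟩
      umbral (- q) 0# ξ n                                ≈⟨ umbral-0# (- q) n ξ ⟩
      P n * ξ n                                          ∎
      where
      a≈-q : q⁻¹ * (- q * q) ≈ - q
      a≈-q = trans (sym (*-assoc _ _ _)) (trans (*-congʳ (inverse-*-neg q⁻¹q≈1)) (-1*x≈-x q))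
      b≈0 : q⁻¹ * - q + 1# ≈ 0#
      b≈0 = trans (+-congʳ (inverse-*-neg q⁻¹q≈1)) (-‿inverseˡ 1#)
    factor : ∀ i P X q U → i * (P * X) + P * ((i * q) * U) ≈ (P * i) * (q * U + X)
    factor = solve 5 (λ i P X q U → i :* (P :* X) :+ P :* ((i :* q) :* U) := (P :* i) :* (q :* U :+ X)) refl

  qEulerPoly-umbral : ∀ Q ξ n x → qEulerPoly Q ξ n x ≈ umbral (pow Q x) (qint Q x) ξ n
  qEulerPoly-umbral Q ξ n x =
    trans (sumTo-cong n (λ l _ → *-congˡ (*-congˡ (*-congʳ (pow-*ℕ Q l x))))) (umbral-sum (pow Q x) (qint Q x) n ξ)

  -- at x = 2 the operator [2]_{q⁻¹} + q⁻² E, applied to (-q)^i (qE + 1)^i, becomes 1 - E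
  qEulerPoly-inverse-two : ∀ {q q⁻¹ ξ ξ′} → q⁻¹ * q ≈ 1# → (∀ i → ξ′ i ≈ umbral (- q * q) (- q) ξ i) →
                           ∀ n → qEulerPoly q⁻¹ ξ′ n 2 ≈ umbral (- 1#) 1# ξ n
  qEulerPoly-inverse-two {q} {q⁻¹} {ξ} {ξ′} q⁻¹q≈1 ξ′≈ n = begin
    qEulerPoly q⁻¹ ξ′ n 2                                     ≈⟨ qEulerPoly-umbral q⁻¹ ξ′ n 2 ⟩
    umbral (pow q⁻¹ 2) (qint q⁻¹ 2) ξ′ n                      ≈⟨ umbral-cong refl refl n ξ′≈ ⟩
    umbral (pow q⁻¹ 2) (qint q⁻¹ 2) (umbral (- q * q) (- q) ξ) n
                                                              ≈⟨ umbral-∘ _ _ _ _ n ξ ⟩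
    umbral (pow q⁻¹ 2 * (- q * q)) (pow q⁻¹ 2 * - q + qint q⁻¹ 2) ξ n
                                                              ≈⟨ umbral-cong a≈-1 b≈1 n (λ _ → refl) ⟩
    umbral (- 1#) 1# ξ n                                      ∎
    where
    q⁻² : Carrier
    q⁻² = q⁻¹ * q⁻¹
    q⁻²-pow : pow q⁻¹ 2 ≈ q⁻²
    q⁻²-pow = *-congˡ (*-identityʳ q⁻¹)
    a≈-1 : pow q⁻¹ 2 * (- q * q) ≈ - 1#
    a≈-1 = begin
      pow q⁻¹ 2 * (- q * q)         ≈⟨ *-congʳ q⁻²-pow ⟩
      q⁻² * (- q * q)               ≈⟨ interchange q⁻¹ q⁻¹ (- q) q ⟩
      (q⁻¹ * - q) * (q⁻¹ * q)       ≈⟨ *-cong (inverse-*-neg q⁻¹q≈1) q⁻¹q≈1 ⟩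
      - 1# * 1#                     ≈⟨ *-identityʳ _ ⟩
      - 1#                          ∎
      where
      interchange : ∀ a b c d → (a * b) * (c * d) ≈ (a * c) * (b * d)
      interchange = solve 4 (λ a b c d → (a :* b) :* (c :* d) := (a :* c) :* (b :* d)) refl
    b≈1 : pow q⁻¹ 2 * - q + qint q⁻¹ 2 ≈ 1#
    b≈1 = begin
      pow q⁻¹ 2 * - q + (1# + q⁻¹ * (1# + q⁻¹ * 0#))
        ≈⟨ +-cong (*-congʳ q⁻²-pow) (+-congˡ (*-congˡ (trans (+-congˡ (zeroʳ q⁻¹)) (+-identityʳ 1#)))) ⟩
      q⁻² * - q + (1# + q⁻¹ * 1#)   ≈⟨ regroup q⁻¹ (- q) 1# ⟩
      (q⁻¹ * - q) * q⁻¹ + q⁻¹ * 1# + 1#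
        ≈⟨ +-congʳ (+-cong (trans (*-congʳ (inverse-*-neg q⁻¹q≈1)) (-1*x≈-x q⁻¹)) (*-identityʳ q⁻¹)) ⟩
      - q⁻¹ + q⁻¹ + 1#              ≈⟨ +-congʳ (-‿inverseˡ q⁻¹) ⟩
      0# + 1#                       ≈⟨ +-identityˡ 1# ⟩
      1#                            ∎
      where
      regroup : ∀ i m o → (i * i) * m + (o + i * o) ≈ (i * m) * i + i * o + o
      regroup = solve 3 (λ i m o → (i :* i) :* m :+ (o :+ i :* o) := (i :* m) :* i :+ i :* o :+ o) refl

theorem6 : ∀ {c ℓ} (R : CommutativeRing c ℓ) →
    let open CommutativeRing R in
    let open QEuler R in
    (q q⁻¹ : Carrier) → q * q⁻¹ ≈ 1# →
    (∀ m → ∃ λ u → (1# + pow q (suc m)) * u ≈ 1#) →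
    (ξ ξ' : ℕ → Carrier) → IsQEulerNumbers q ξ → IsQEulerNumbers q⁻¹ ξ' →
    (n k : ℕ) → k ≤ n →
    sumTo (n ∸ k) (λ l → fromℕ ((n ∸ k) C l) * (sign l * ξ (k ℕ.+ l)))
      ≈ sumTo k (λ l → fromℕ (k C l) * (sign (k ℕ.+ l) * qEulerPoly q⁻¹ ξ' (n ∸ l) 2))
theorem6 R q q⁻¹ qq⁻¹≈1 units ξ ξ' isξ isξ' n k k≤n = begin
  sumTo (n ∸ k) (λ l → fromℕ ((n ∸ k) C l) * (sign l * ξ (k ℕ.+ l)))
    ≈⟨ umbral-sum₁ (- 1#) (n ∸ k) (λ l → ξ (k ℕ.+ l)) ⟩
  umbral (- 1#) 1# (λ l → ξ (k ℕ.+ l)) (n ∸ k)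
    ≈⟨ umbral-alternating ξ k (n ∸ k) ⟨
  umbral 1# (- 1#) (λ l → η (k ℕ.+ (n ∸ k) ∸ l)) k
    ≡⟨ P.cong (λ m → umbral 1# (- 1#) (λ l → η (m ∸ l)) k) (ℕ.m+[n∸m]≡n k≤n) ⟩
  umbral 1# (- 1#) (λ l → η (n ∸ l)) k
    ≈⟨ umbral-sum 1# (- 1#) k (λ l → η (n ∸ l)) ⟨
  sumTo k (λ l → fromℕ (k C l) * (sign (k ∸ l) * (pow 1# l * η (n ∸ l))))
    ≈⟨ sumTo-cong k (λ l l≤k → *-congˡ (*-cong (sign-∸ l≤k) (trans (*-congʳ (pow-1# l)) (*-identityˡ _)))) ⟩
  sumTo k (λ l → fromℕ (k C l) * (sign (k ℕ.+ l) * η (n ∸ l)))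
    ≈⟨ sumTo-cong k (λ l _ → *-congˡ (*-congˡ (qEulerPoly-inverse-two q⁻¹q≈1 ξ'≈ξ⁻ (n ∸ l)))) ⟨
  sumTo k (λ l → fromℕ (k C l) * (sign (k ℕ.+ l) * qEulerPoly q⁻¹ ξ' (n ∸ l) 2)) ∎
  where
  open CommutativeRing R
  open QEuler R
  open UmbralCalculus R
  open QEulerNumbers R
  open SetoidReasoning setoid
  η : ℕ → Carrier
  η = umbral (- 1#) 1# ξ
  q⁻¹q≈1 : q⁻¹ * q ≈ 1#
  q⁻¹q≈1 = trans (*-comm q⁻¹ q) qq⁻¹≈1
  ξ'≈ξ⁻ : ∀ i → ξ' i ≈ umbral (- q * q) (- q) ξ i
  ξ'≈ξ⁻ = qEuler-unique (hasUnitShifts-inverse qq⁻¹≈1 units) isξ' (qEuler-inverse q⁻¹q≈1 isξ)
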